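{- Let $a,b,c,d$ be four distinct letters and $\mu$ as in the context. Then for every $n\ge1$ the iterate $\mu^n(d)=\mu(\mu^{n-1}(d))$ is defined, and the limit $\mu^{\omega}(d)=\lim_{n\to\infty}\mu^n(d)$ exists, i.e. there is a unique infinite array $w:\mathbb{N}\times\mathbb{N}\to\{a,b,c,d\}$ such that every $\mu^n(d)$ is its top-left prefix (the restriction of $w$ to the first rows and columns of the size of $\mu^n(d)$), with the sizes of $\mu^n(d)$ tending to infinity in both directions.
   Context: For arrays $u,v$ with equal numbers of rows, $u\circ_c v$ places $v$ to the right of $u$; with equal numbers of columns, $u\circ_r v$ places $v$ below $u$. $\mu(d)=\begin{smallmatrix} d & c\\ b & a\end{smallmatrix}$, $\mu(c)=\begin{smallmatrix} d\\ b\end{smallmatrix}$ ($2\times1$), $\mu(b)=\begin{smallmatrix} d & c\end{smallmatrix}$ ($1\times2$), $\mu(a)=d$. For an array $x=[x_{i,j}]$ of size $(p,q)$ such that for each $i$ all $\mu(x_{i,j})$ have the same number of rows and for each $j$ all $\mu(x_{i,j})$ have the same number of columns, $\mu(x)=R_1\circ_r\cdots\circ_r R_p$ with $R_i=\mu(x_{i,1})\circ_c\cdots\circ_c\mu(x_{i,q})$. The limit is called the infinite 2D Fibonacci word $f_{\infty,\infty}$. -}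

module Defs where

open import Data.Nat using (ℕ; zero; suc; _+_; _≟_)
open import Data.Fin using (Fin; zero; suc; splitAt)
open import Data.Fin.Properties using (all?)
open import Data.Sum using ([_,_])
open import Data.Maybe using (Maybe; just; nothing; _>>=_)
open import Relation.Nullary using (yes; no)
open import Relation.Binary.PropositionalEquality using (_≡_; subst; sym)

data Letter : Set where
  a b c d : Letter

record Array : Set where
  constructor mkArray
  field
    rows : ℕ
    cols : ℕ
    ent  : Fin rows → Fin cols → Letter
open Array public

_∘c_ : Array → Array → Maybe Array
u ∘c v with rows u ≟ rows v
... | no _ = nothing
... | yes eq = just (mkArray (rows u) (cols u + cols v)
    (λ i k → [ ent u i , ent v (subst Fin eq i) ] (splitAt (cols u) k)))

_∘r_ : Array → Array → Maybe Array
u ∘r v with cols u ≟ cols v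
... | no _ = nothing
... | yes eq = just (mkArray (rows u + rows v) (cols u)
    (λ k j → [ (λ i → ent u i j) , (λ i → ent v i (subst Fin eq j)) ] (splitAt (rows u) k)))

hcatAll : ∀ {q} → (Fin (suc q) → Maybe Array) → Maybe Array
hcatAll {zero} f = f zero
hcatAll {suc q} f = f zero >>= λ u → hcatAll (λ j → f (suc j)) >>= λ v → u ∘c v

vcatAll : ∀ {p} → (Fin (suc p) → Maybe Array) → Maybe Array
vcatAll {zero} f = f zero
vcatAll {suc p} f = f zero >>= λ u → vcatAll (λ i → f (suc i)) >>= λ v → u ∘r v

μL : Letter → Array
μL d = mkArray 2 2 (λ { zero zero → d ; zero (suc _) → c ; (suc _) zero → b ; (suc _) (suc _) → a })
μL c = mkArray 2 1 (λ { zero _ → d ; (suc _) _ → b })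
μL b = mkArray 1 2 (λ { _ zero → d ; _ (suc _) → c })
μL a = mkArray 1 1 (λ _ _ → d)

μ : Array → Maybe Array
μ (mkArray zero q x) = nothing
μ (mkArray (suc p) zero x) = nothing
μ (mkArray (suc p) (suc q) x)
  with all? (λ i → all? (λ j → rows (μL (x i j)) ≟ rows (μL (x i zero))))
     | all? (λ j → all? (λ i → cols (μL (x i j)) ≟ cols (μL (x zero j))))
... | yes _ | yes _ = vcatAll (λ i → hcatAll (λ j → just (μL (x i j))))
... | _ | _ = nothing

single : Letter → Array
single l = mkArray 1 1 (λ _ _ → l)

μIter : ℕ → Maybe Array
μIter zero = just (single d)
μIter (suc n) = μIter n >>= μ

IsPrefixOf : Array → (ℕ → ℕ → Letter) → Set
IsPrefixOf A w = ∀ (i : Fin (rows A)) (j : Fin (cols A)) →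
  ent A i j ≡ w (Data.Fin.toℕ i) (Data.Fin.toℕ j)

{-# OPTIONS --safe #-}
-- Encode a, b, c, d as pairs of bits, d = (0,0), c = (0,1), b = (1,0), a = (1,1).
-- Then μ acts on a letter (s,t) as the "tensor product" of σ(s) and σ(t), where
-- σ : 0 ↦ 01, 1 ↦ 0 is the one-dimensional Fibonacci morphism: the entry at (i,j)
-- of μ(s,t) is (σ(s)ᵢ, σ(t)ⱼ). Tensor arrays are closed under ∘c and ∘r, hence
-- μ(u ⊗ v) = σ(u) ⊗ σ(v), and by induction μⁿ(d) = Fₙ ⊗ Fₙ with Fₙ = σⁿ(0) the
-- n-th Fibonacci word. Since each Fₙ is a prefix of Fₙ₊₁ and |Fₙ| > n, the
-- limit is f ⊗ f for the infinite Fibonacci word f.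
module Submission where

open import Defs
open import Data.Nat using (ℕ; zero; suc; _+_; _≤_; _<_; _≤′_; ≤′-refl; ≤′-step; z≤n; s≤s; _≟_)
open import Data.Nat.Properties
  using (≤⇒≤′; <⇒≤; ≤-trans; ≤-total; n≤1+n; m≤n⇒m≤1+n; m≤m+n; m≤n+m)
open import Data.Maybe using (Maybe; just)
open import Data.Maybe.Properties using (just-injective)
open import Data.Product using (_×_; ∃-syntax; _,_)
open import Data.Sum using (inj₁; inj₂; [_,_])
open import Data.List using (List; []; _∷_; _++_; length; concatMap)
open import Data.List.Properties using (length-++; ++-assoc; ++-identityʳ; concatMap-++)
open import Data.Fin using (Fin; zero; suc; toℕ; splitAt; fromℕ<)
open import Data.Fin.Properties
  using (all?; splitAt⁻¹-↑ˡ; splitAt⁻¹-↑ʳ; toℕ-↑ˡ; toℕ-↑ʳ; toℕ<n; toℕ-fromℕ<)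
open import Data.Empty using (⊥-elim)
open import Relation.Nullary using (yes; no)
open import Relation.Binary.PropositionalEquality
  using (_≡_; refl; sym; trans; cong; cong₂; subst; subst₂; module ≡-Reasoning)

data Bit : Set where
  O I : Bit

letter : Bit → Bit → Letter
letter O O = d
letter O I = c
letter I O = b
letter I I = a

-- Out-of-range positions read O; only in-range positions are ever used.
at : List Bit → ℕ → Bit
at []       _       = O
at (x ∷ xs) zero    = x
at (x ∷ xs) (suc k) = at xs k

at-++ˡ : ∀ (u v : List Bit) k → k < length u → at (u ++ v) k ≡ at u k
at-++ˡ (x ∷ u) v zero    _       = refl
at-++ˡ (x ∷ u) v (suc k) (s≤s p) = at-++ˡ u v k p

at-++ʳ : ∀ (u v : List Bit) k → at (u ++ v) (length u + k) ≡ at v k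
at-++ʳ []      v k = refl
at-++ʳ (x ∷ u) v k = at-++ʳ u v k

at-extension : ∀ {w u : List Bit} t → w ≡ u ++ t → ∀ k → k < length u → at w k ≡ at u k
at-extension {u = u} t refl k = at-++ˡ u t k

toℕ-subst : ∀ {m n} (e : m ≡ n) (i : Fin m) → toℕ (subst Fin e i) ≡ toℕ i
toℕ-subst refl i = refl

splitAt-at-++ : ∀ {X : Set} (u v : List Bit) (k : Fin (length u + length v))
  (f : Fin (length u) → X) (g : Fin (length v) → X) (h : Bit → X)
  → (∀ i → f i ≡ h (at u (toℕ i))) → (∀ j → g j ≡ h (at v (toℕ j)))
  → [ f , g ] (splitAt (length u) k) ≡ h (at (u ++ v) (toℕ k))
splitAt-at-++ u v k f g h hf hg with splitAt (length u) k in eq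
... | inj₁ i = begin
  f i                               ≡⟨ hf i ⟩
  h (at u (toℕ i))                  ≡⟨ cong h (at-++ˡ u v (toℕ i) (toℕ<n i)) ⟨
  h (at (u ++ v) (toℕ i))           ≡⟨ cong (λ n → h (at (u ++ v) n)) toℕ-k ⟨
  h (at (u ++ v) (toℕ k))           ∎
  where
  open ≡-Reasoning
  toℕ-k : toℕ k ≡ toℕ i
  toℕ-k = trans (cong toℕ (sym (splitAt⁻¹-↑ˡ eq))) (toℕ-↑ˡ i _)
... | inj₂ j = begin
  g j                               ≡⟨ hg j ⟩
  h (at v (toℕ j))                  ≡⟨ cong h (at-++ʳ u v (toℕ j)) ⟨
  h (at (u ++ v) (length u + toℕ j)) ≡⟨ cong (λ n → h (at (u ++ v) n)) toℕ-k ⟨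
  h (at (u ++ v) (toℕ k))           ∎
  where
  open ≡-Reasoning
  toℕ-k : toℕ k ≡ length u + toℕ j
  toℕ-k = trans (cong toℕ (sym (splitAt⁻¹-↑ʳ eq))) (toℕ-↑ʳ (length u) j)

record IsTensor (A : Array) (u v : List Bit) : Set where
  field
    rows≡ : rows A ≡ length u
    cols≡ : cols A ≡ length v
    ent≡  : ∀ i j → ent A i j ≡ letter (at u (toℕ i)) (at v (toℕ j))
open IsTensor

∘c-IsTensor : ∀ {A B : Array} {u v v′} → IsTensor A u v → IsTensor B u v′
  → ∃[ C ] ((A ∘c B ≡ just C) × IsTensor C u (v ++ v′))
∘c-IsTensor {mkArray _ _ x} {mkArray _ _ y} {u} {v} {v′}
  record { rows≡ = refl ; cols≡ = refl ; ent≡ = ex }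
  record { rows≡ = refl ; cols≡ = refl ; ent≡ = ey }
  with length u ≟ length u
... | no ≢ = ⊥-elim (≢ refl)
... | yes eq = _ , refl , record
  { rows≡ = refl
  ; cols≡ = sym (length-++ v)
  ; ent≡  = λ i k → splitAt-at-++ v v′ k (x i) (y (subst Fin eq i)) (letter (at u (toℕ i))) (ex i)
      (λ j → trans (ey (subst Fin eq i) j)
                   (cong (λ n → letter (at u n) (at v′ (toℕ j))) (toℕ-subst eq i)))
  }

∘r-IsTensor : ∀ {A B : Array} {u u′ v} → IsTensor A u v → IsTensor B u′ v
  → ∃[ C ] ((A ∘r B ≡ just C) × IsTensor C (u ++ u′) v)
∘r-IsTensor {mkArray _ _ x} {mkArray _ _ y} {u} {u′} {v}
  record { rows≡ = refl ; cols≡ = refl ; ent≡ = ex }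
  record { rows≡ = refl ; cols≡ = refl ; ent≡ = ey }
  with length v ≟ length v
... | no ≢ = ⊥-elim (≢ refl)
... | yes eq = _ , refl , record
  { rows≡ = sym (length-++ u)
  ; cols≡ = refl
  ; ent≡  = λ k j → splitAt-at-++ u u′ k (λ i → x i j) (λ i → y i (subst Fin eq j))
      (λ s → letter s (at v (toℕ j))) (λ i → ex i j)
      (λ i → trans (ey i (subst Fin eq j))
                   (cong (λ n → letter (at u′ (toℕ i)) (at v n)) (toℕ-subst eq j)))
  }

σ : Bit → List Bit
σ O = O ∷ I ∷ []
σ I = O ∷ []

σ* : List Bit → List Bit
σ* = concatMap σ

μL-IsTensor : ∀ s t → IsTensor (μL (letter s t)) (σ s) (σ t)
μL-IsTensor O O = record { rows≡ = refl ; cols≡ = refl ; ent≡ = λ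
  { zero zero → refl ; zero (suc zero) → refl ; (suc zero) zero → refl ; (suc zero) (suc zero) → refl } }
μL-IsTensor O I = record { rows≡ = refl ; cols≡ = refl ; ent≡ = λ { zero zero → refl ; (suc zero) zero → refl } }
μL-IsTensor I O = record { rows≡ = refl ; cols≡ = refl ; ent≡ = λ { zero zero → refl ; zero (suc zero) → refl } }
μL-IsTensor I I = record { rows≡ = refl ; cols≡ = refl ; ent≡ = λ { zero zero → refl } }

hcatAll-IsTensor : ∀ s t ts (f : Fin (suc (length ts)) → Maybe Array)
  → (∀ j → f j ≡ just (μL (letter s (at (t ∷ ts) (toℕ j)))))
  → ∃[ B ] ((hcatAll f ≡ just B) × IsTensor B (σ s) (σ* (t ∷ ts)))
hcatAll-IsTensor s t [] f hf rewrite hf zero =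
  _ , refl , subst (IsTensor _ (σ s)) (sym (++-identityʳ (σ t))) (μL-IsTensor s t)
hcatAll-IsTensor s t (t′ ∷ ts) f hf rewrite hf zero
  with hcatAll-IsTensor s t′ ts (λ j → f (suc j)) (λ j → hf (suc j))
... | _ , eq , tensor rewrite eq = ∘c-IsTensor (μL-IsTensor s t) tensor

vcatAll-IsTensor : ∀ u us v (f : Fin (suc (length us)) → Maybe Array)
  → (∀ i → ∃[ B ] ((f i ≡ just B) × IsTensor B (σ (at (u ∷ us) (toℕ i))) v))
  → ∃[ B ] ((vcatAll f ≡ just B) × IsTensor B (σ* (u ∷ us)) v)
vcatAll-IsTensor u [] v f hf with hf zero
... | B , eq , tensor rewrite eq =
  B , refl , subst (λ w → IsTensor B w v) (sym (++-identityʳ (σ u))) tensor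
vcatAll-IsTensor u (u′ ∷ us) v f hf
  with hf zero | vcatAll-IsTensor u′ us v (λ i → f (suc i)) (λ i → hf (suc i))
... | _ , eq , tensor | _ , eq′ , tensor′ rewrite eq | eq′ = ∘r-IsTensor tensor tensor′

μ-IsTensor : ∀ {A} u us v vs → IsTensor A (u ∷ us) (v ∷ vs)
  → ∃[ B ] ((μ A ≡ just B) × IsTensor B (σ* (u ∷ us)) (σ* (v ∷ vs)))
μ-IsTensor {mkArray _ _ x} u us v vs record { rows≡ = refl ; cols≡ = refl ; ent≡ = ex }
  with all? (λ i → all? (λ j → rows (μL (x i j)) ≟ rows (μL (x i zero))))
     | all? (λ j → all? (λ i → cols (μL (x i j)) ≟ cols (μL (x zero j))))
... | yes _ | yes _ = vcatAll-IsTensor u us (σ* (v ∷ vs)) _ λ i →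
        hcatAll-IsTensor (at (u ∷ us) (toℕ i)) v vs _ (λ j → cong (λ l → just (μL l)) (ex i j))
... | no rows≢ | _ = ⊥-elim (rows≢ λ i j → trans (rows-μL i j) (sym (rows-μL i zero)))
  where
  rows-μL : ∀ i j → rows (μL (x i j)) ≡ length (σ (at (u ∷ us) (toℕ i)))
  rows-μL i j = trans (cong (λ l → rows (μL l)) (ex i j)) (rows≡ (μL-IsTensor (at (u ∷ us) (toℕ i)) (at (v ∷ vs) (toℕ j))))
... | yes _ | no cols≢ = ⊥-elim (cols≢ λ j i → trans (cols-μL i j) (sym (cols-μL zero j)))
  where
  cols-μL : ∀ i j → cols (μL (x i j)) ≡ length (σ (at (v ∷ vs) (toℕ j)))
  cols-μL i j = trans (cong (λ l → cols (μL l)) (ex i j)) (cols≡ (μL-IsTensor (at (u ∷ us) (toℕ i)) (at (v ∷ vs) (toℕ j))))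

fibWord : ℕ → List Bit
fibWord zero    = O ∷ []
fibWord (suc n) = σ* (fibWord n)

fibWord-head : ∀ n → ∃[ r ] fibWord n ≡ O ∷ r
fibWord-head zero = [] , refl
fibWord-head (suc n) with fibWord n | fibWord-head n
... | _ | r , refl = I ∷ σ* r , refl

fibWord-⊑-suc : ∀ n → ∃[ t ] fibWord (suc n) ≡ fibWord n ++ t
fibWord-⊑-suc zero = I ∷ [] , refl
fibWord-⊑-suc (suc n) with fibWord-⊑-suc n
... | t , eq = σ* t , trans (cong σ* eq) (concatMap-++ σ (fibWord n) t)

fibWord-⊑ : ∀ {m n} → m ≤′ n → ∃[ t ] fibWord n ≡ fibWord m ++ t
fibWord-⊑ {m} ≤′-refl = [] , sym (++-identityʳ (fibWord m))
fibWord-⊑ {m} (≤′-step {n} m≤n) with fibWord-⊑ m≤n | fibWord-⊑-suc n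
... | t , eq | t′ , eq′ = t ++ t′ , (begin
  fibWord (suc n)            ≡⟨ eq′ ⟩
  fibWord n ++ t′            ≡⟨ cong (_++ t′) eq ⟩
  (fibWord m ++ t) ++ t′     ≡⟨ ++-assoc (fibWord m) t t′ ⟩
  fibWord m ++ (t ++ t′)     ∎)
  where open ≡-Reasoning

length≤length-σ* : ∀ w → length w ≤ length (σ* w)
length≤length-σ* []      = z≤n
length≤length-σ* (O ∷ w) = s≤s (m≤n⇒m≤1+n (length≤length-σ* w))
length≤length-σ* (I ∷ w) = s≤s (length≤length-σ* w)

-- Fₙ₊₁ = σ*(0 ∷ r) = 0 ∷ 1 ∷ σ*(r) gains at least one letter.
length-fibWord : ∀ n → n < length (fibWord n)
length-fibWord zero = s≤s z≤n
length-fibWord (suc n) with fibWord n | fibWord-head n | length-fibWord n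
... | _ | r , refl | n<len = ≤-trans (s≤s n<len) (s≤s (s≤s (length≤length-σ* r)))

fibonacci : ℕ → Bit
fibonacci k = at (fibWord (suc k)) k

at-fibWord : ∀ n k → k < length (fibWord n) → at (fibWord n) k ≡ fibonacci k
at-fibWord n k k<len with ≤-total n (suc k)
... | inj₁ n≤k+1 with fibWord-⊑ (≤⇒≤′ n≤k+1)
...   | t , eq = sym (at-extension t eq k k<len)
at-fibWord n k k<len | inj₂ k+1≤n with fibWord-⊑ (≤⇒≤′ k+1≤n)
...   | t , eq = at-extension t eq k (≤-trans (n≤1+n (suc k)) (length-fibWord (suc k)))

μIter-IsTensor : ∀ n → ∃[ A ] ((μIter n ≡ just A) × IsTensor A (fibWord n) (fibWord n))
μIter-IsTensor zero = single d , refl , record { rows≡ = refl ; cols≡ = refl ; ent≡ = λ { zero zero → refl } }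
μIter-IsTensor (suc n) with μIter-IsTensor n | fibWord-head n
... | A , eq , tensor | r , head rewrite eq
  with μ-IsTensor O r O r (subst₂ (IsTensor A) head head tensor)
...   | B , eqB , tensorB = B , eqB , subst₂ (IsTensor B) (cong σ* (sym head)) (cong σ* (sym head)) tensorB

IsTensor-μIter : ∀ n A → μIter n ≡ just A → IsTensor A (fibWord n) (fibWord n)
IsTensor-μIter n A eq with μIter-IsTensor n
... | A′ , eq′ , tensor = subst (λ B → IsTensor B (fibWord n) (fibWord n)) (just-injective (trans (sym eq′) eq)) tensor

fibonacci² : ℕ → ℕ → Letter
fibonacci² i j = letter (fibonacci i) (fibonacci j)

μIter-IsPrefixOf : ∀ n A → μIter n ≡ just A → IsPrefixOf A fibonacci²
μIter-IsPrefixOf n A eq i j =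
  trans (ent≡ tensor i j) (cong₂ letter (at-fibWord n (toℕ i) i<len) (at-fibWord n (toℕ j) j<len))
  where
  tensor : IsTensor A (fibWord n) (fibWord n)
  tensor = IsTensor-μIter n A eq
  i<len : toℕ i < length (fibWord n)
  i<len = subst (toℕ i <_) (rows≡ tensor) (toℕ<n i)
  j<len : toℕ j < length (fibWord n)
  j<len = subst (toℕ j <_) (cols≡ tensor) (toℕ<n j)

-- μⁱ⁺ʲ(d) already covers position (i, j), since |Fₙ| > n.
μIter-prefix-unique : ∀ (w : ℕ → ℕ → Letter)
  → (∀ n A → μIter n ≡ just A → IsPrefixOf A w)
  → ∀ i j → w i j ≡ fibonacci² i j
μIter-prefix-unique w prefix i j with μIter-IsTensor (i + j)
... | A , eq , tensor = begin
  w i j                    ≡⟨ cong₂ w (toℕ-fromℕ< i<rows) (toℕ-fromℕ< j<cols) ⟨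
  w (toℕ i′) (toℕ j′)      ≡⟨ prefix (i + j) A eq i′ j′ ⟨
  ent A i′ j′              ≡⟨ μIter-IsPrefixOf (i + j) A eq i′ j′ ⟩
  fibonacci² (toℕ i′) (toℕ j′) ≡⟨ cong₂ fibonacci² (toℕ-fromℕ< i<rows) (toℕ-fromℕ< j<cols) ⟩
  fibonacci² i j           ∎
  where
  open ≡-Reasoning
  i<rows : i < rows A
  i<rows = subst (i <_) (sym (rows≡ tensor)) (≤-trans (s≤s (m≤m+n i j)) (length-fibWord (i + j)))
  j<cols : j < cols A
  j<cols = subst (j <_) (sym (cols≡ tensor)) (≤-trans (s≤s (m≤n+m j i)) (length-fibWord (i + j)))
  i′ : Fin (rows A)
  i′ = fromℕ< i<rows
  j′ : Fin (cols A)
  j′ = fromℕ< j<cols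

μIter-size : ∀ n A → μIter n ≡ just A → (n < rows A) × (n < cols A)
μIter-size n A eq =
    subst (n <_) (sym (rows≡ tensor)) (length-fibWord n)
  , subst (n <_) (sym (cols≡ tensor)) (length-fibWord n)
  where
  tensor : IsTensor A (fibWord n) (fibWord n)
  tensor = IsTensor-μIter n A eq

corollary3 :
    (∀ (n : ℕ) → 1 ≤ n → ∃[ A ] μIter n ≡ just A)
    × (∃[ w ] ((∀ (n : ℕ) (A : Array) → μIter n ≡ just A → IsPrefixOf A w)
        × (∀ (w′ : ℕ → ℕ → Letter)
             → (∀ (n : ℕ) (A : Array) → μIter n ≡ just A → IsPrefixOf A w′)
             → ∀ (i j : ℕ) → w′ i j ≡ w i j)))
    × (∀ (N : ℕ) → ∃[ n₀ ] (∀ (n : ℕ) (A : Array) → n₀ ≤ n → μIter n ≡ just A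
        → (N ≤ rows A) × (N ≤ cols A)))
corollary3 =
    (λ n _ → let A , eq , _ = μIter-IsTensor n in A , eq)
  , (fibonacci² , μIter-IsPrefixOf , μIter-prefix-unique)
  , λ N → N , λ n A N≤n eq → let n<rows , n<cols = μIter-size n A eq in
      ≤-trans N≤n (<⇒≤ n<rows) , ≤-trans N≤n (<⇒≤ n<cols)
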